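{- For all $\varepsilon>0$ and integers $b\geq 2$ there exist $\gamma=\gamma(\varepsilon,b)>0$ and $n(\varepsilon,b)$ such that for every $n>n(\varepsilon,b)$ the following holds: if the edges of the complete graph $K_n$ are coloured red, blue and green so that there are fewer than $\gamma n^2$ green edges, then there exists a partition $V(K_n)=\bigcup_{i=0}^{q}V_i$ such that $|V_0|<\varepsilon n$, $|V_1|=\dots=|V_q|=b$, and for every $i\in[q]$ the set $V_i$ spans either a red or a blue $b$-clique (i.e. all edges inside $V_i$ are red, or all are blue).
   Context: $[q]=\{1,\dots,q\}$. -}

module Defs where

open import Data.Nat using (ℕ; zero; suc; _+_; _<ᵇ_)
open import Data.Bool using (Bool; true; false; if_then_else_; _∧_)
open import Data.Fin using (Fin; toℕ; _≟_)
open import Data.List using (List; allFin; cartesianProduct)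
open import Data.Product using (Σ; _×_; _,_)
open import Data.Sum using (_⊎_)
open import Data.Integer using (+_)
open import Data.Rational using (ℚ; _/_)
open import Relation.Nullary using (¬_)
open import Relation.Nullary.Decidable using (⌊_⌋)
open import Relation.Binary.PropositionalEquality using (_≡_)

data Colour : Set where
  red blue green : Colour

isGreen : Colour → Bool
isGreen green = true
isGreen _     = false

-- A colouring of the edges of K_n on vertex set Fin n: the colour of edge {u,v}
-- is c u v (diagonal values are irrelevant); it must be symmetric.
Colouring : ℕ → Set
Colouring n = Fin n → Fin n → Colour

SymmetricColouring : ∀ {n} → Colouring n → Set
SymmetricColouring {n} c = (u v : Fin n) → c u v ≡ c v u

count : ∀ {A : Set} → (A → Bool) → List A → ℕ
count p List.[] = 0
count p (x List.∷ xs) = if p x then suc (count p xs) else count p xs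

greenEdges : ∀ {n} → Colouring n → ℕ
greenEdges {n} c =
  count (λ { (u , v) → (toℕ u <ᵇ toℕ v) ∧ isGreen (c u v) })
        (cartesianProduct (allFin n) (allFin n))

-- Size of block i of the partition given by the map part : V → Fin (suc q)
-- (block number zero is V_0).
blockSize : ∀ {n q} → (Fin n → Fin (suc q)) → Fin (suc q) → ℕ
blockSize {n} part i = count (λ v → ⌊ part v ≟ i ⌋) (allFin n)

MonoRedOrBlue : ∀ {n q} → Colouring n → (Fin n → Fin (suc q)) → Fin (suc q) → Set
MonoRedOrBlue {n} c part i =
  Σ Colour λ col → (col ≡ red ⊎ col ≡ blue) ×
    ((u v : Fin n) → part u ≡ i → part v ≡ i → ¬ (u ≡ v) → c u v ≡ col)

ℕtoℚ : ℕ → ℚ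
ℕtoℚ m = + m / 1

module Submission where

-- Fix k with ε ≥ 1/k, put A = 4k·4^b and γ = 1/(2kA + 1), and call a vertex high when it has at
-- least n/A green edges to later vertices. There are fewer than γn² green edges, so by Markov's
-- inequality fewer than n/(2k) vertices are high. While at least 4^b(n/A + 1) low vertices are
-- still in V₀, pick greedily 4^b of them spanning no green edge (each pick discards fewer than n/A
-- later vertices); by the Erdős–Szekeres bound R(b, b) ≤ 4^b they contain a red or a blue b-clique,
-- which becomes a new block. When this stops, fewer than n/(2k) low vertices are left in V₀ as
-- soon as n > A, so |V₀| < n/k ≤ εn.

open import Defs
open import Data.Bool using (Bool; true; false; not; _∧_; _∨_; T; T?)
open import Data.Bool.Properties using (T-∧; T-∨; T-≡; ∨-zeroʳ; ∨-identityʳ)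
open import Data.Empty using (⊥; ⊥-elim)
open import Data.Fin using (Fin; zero; suc; toℕ; _≟_; punchIn)
open import Data.Fin.Properties using (toℕ-injective; suc-injective; punchIn-injective; punchInᵢ≢i)
import Data.Integer as ℤ
import Data.Integer.Properties as ℤP
open import Data.List using (List; []; _∷_; _++_; map; length; allFin; tabulate; cartesianProduct)
open import Data.List.Membership.Propositional using (_∈_)
import Data.List.Membership.DecPropositional as DecMembership
open module FinMembership {n} = DecMembership (_≟_ {n}) using (_∈?_)
open import Data.List.Relation.Binary.Sublist.Propositional using (_⊆_; []; _∷_; _∷ʳ_; minimum; ⊆-trans)
open import Data.List.Relation.Binary.Sublist.Propositional.Properties using (All-resp-⊆)
open import Data.List.Relation.Unary.All using (All; []; _∷_)
import Data.List.Relation.Unary.All as All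
open import Data.List.Relation.Unary.AllPairs using (AllPairs; []; _∷_)
import Data.List.Relation.Unary.AllPairs as AllPairs
open import Data.List.Relation.Unary.Any using (here; there)
open import Data.List.Relation.Unary.Unique.Propositional using (Unique)
open import Data.Nat using (ℕ; zero; suc; _+_; _*_; _^_; _≤_; _<_; _≤?_; _<?_; _<ᵇ_; _≤ᵇ_; z≤n; s≤s; z<s; >-nonZero)
open import Data.Nat.Coprimality using (Coprime; 1-coprimeTo)
open import Data.Nat.Properties hiding (_≟_; suc-injective)
open import Data.Nat.Tactic.RingSolver using (solve-∀)
open import Data.Product using (Σ; ∃-syntax; _×_; _,_; proj₁; proj₂)
open import Data.Rational using (ℚ; 0ℚ; mkℚ; toℚᵘ; *<*) renaming (_<_ to _<ℚ_; _*_ to _*ℚ_)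
import Data.Rational.Properties as ℚP
open import Data.Rational.Unnormalised using (mkℚᵘ)
  renaming (_<_ to _<ᵘ_; _*_ to _*ᵘ_; _≃_ to _≃ᵘ_; *<* to *<*ᵘ)
import Data.Rational.Unnormalised.Properties as ℚᵘP
open import Data.Sum using (_⊎_; inj₁; inj₂; [_,_]′)
open import Function using (_∘_; id; Equivalence)
open import Relation.Binary.Definitions using (tri<; tri≈; tri>)
open import Relation.Binary.PropositionalEquality
  using (_≡_; _≢_; refl; sym; trans; cong; cong₂; subst; subst₂; module ≡-Reasoning)
open import Relation.Nullary using (¬_; yes; no)
open import Relation.Nullary.Decidable
  using (⌊_⌋; fromWitness; toWitness; dec-true; dec-false; isYes≗does; ⌊⌋-map′)

open import Algebra.Properties.CommutativeSemigroup +-commutativeSemigroup using (interchange)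
open import Algebra.Properties.Semiring.Sum +-*-semiring
  using (sum; sum-cong-≗; sum-replicate-zero; *-distribʳ-sum)

-- Counting over Fin n

⟦_⟧ : Bool → ℕ
⟦ true ⟧  = 1
⟦ false ⟧ = 0

T-∧⁻ : ∀ a {b} → T (a ∧ b) → T a × T b
T-∧⁻ _ = Equivalence.to T-∧

T-∧⁺ : ∀ {a b} → T a × T b → T (a ∧ b)
T-∧⁺ = Equivalence.from T-∧

T-∨⁺ : ∀ a {b} → T a ⊎ T b → T (a ∨ b)
T-∨⁺ _ = Equivalence.from T-∨

T-not⇒¬T : ∀ a → T (not a) → ¬ T a
T-not⇒¬T false _ ()

¬T⇒T-not : ∀ a → ¬ T a → T (not a)
¬T⇒T-not true  ¬a = ¬a _
¬T⇒T-not false _  = _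

countFin : ∀ {n} → (Fin n → Bool) → ℕ
countFin p = sum (⟦_⟧ ∘ p)

sum-mono-≤ : ∀ {n} {f g : Fin n → ℕ} → (∀ v → f v ≤ g v) → sum f ≤ sum g
sum-mono-≤ {zero}  f≤g = z≤n
sum-mono-≤ {suc n} f≤g = +-mono-≤ (f≤g zero) (sum-mono-≤ (f≤g ∘ suc))

sum-distrib-+ : ∀ {n} (f g : Fin n → ℕ) → sum (λ v → f v + g v) ≡ sum f + sum g
sum-distrib-+ {zero}  f g = refl
sum-distrib-+ {suc n} f g =
  trans (cong (f zero + g zero +_) (sum-distrib-+ (f ∘ suc) (g ∘ suc)))
        (interchange (f zero) (g zero) (sum (f ∘ suc)) (sum (g ∘ suc)))

module _ {n : ℕ} (p q : Fin n → Bool) where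

  countFin-cong : (∀ v → p v ≡ q v) → countFin p ≡ countFin q
  countFin-cong p≗q = sum-cong-≗ (cong ⟦_⟧ ∘ p≗q)

  countFin-mono : (∀ v → T (p v) → T (q v)) → countFin p ≤ countFin q
  countFin-mono p⇒q = sum-mono-≤ λ v → ⟦⟧-mono (p v) (q v) (p⇒q v)
    where
    ⟦⟧-mono : ∀ a b → (T a → T b) → ⟦ a ⟧ ≤ ⟦ b ⟧
    ⟦⟧-mono false b     _   = z≤n
    ⟦⟧-mono true  true  _   = ≤-refl
    ⟦⟧-mono true  false a⇒b = ⊥-elim (a⇒b _)

  countFin-∨ : countFin (λ v → p v ∨ q v) ≤ countFin p + countFin q
  countFin-∨ = ≤-trans (sum-mono-≤ λ v → ⟦∨⟧≤ (p v) (q v)) (≤-reflexive (sum-distrib-+ (⟦_⟧ ∘ p) (⟦_⟧ ∘ q)))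
    where
    ⟦∨⟧≤ : ∀ a b → ⟦ a ∨ b ⟧ ≤ ⟦ a ⟧ + ⟦ b ⟧
    ⟦∨⟧≤ true  b = s≤s z≤n
    ⟦∨⟧≤ false b = ≤-refl

  countFin-∨-disjoint : (∀ v → T (p v) → T (q v) → ⊥) →
                        countFin (λ v → p v ∨ q v) ≡ countFin p + countFin q
  countFin-∨-disjoint disj =
    trans (sum-cong-≗ λ v → ⟦∨⟧ (p v) (q v) (disj v)) (sum-distrib-+ (⟦_⟧ ∘ p) (⟦_⟧ ∘ q))
    where
    ⟦∨⟧ : ∀ a b → (T a → T b → ⊥) → ⟦ a ∨ b ⟧ ≡ ⟦ a ⟧ + ⟦ b ⟧
    ⟦∨⟧ true  true  disj = ⊥-elim (disj _ _)
    ⟦∨⟧ true  false _ = refl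
    ⟦∨⟧ false b     _ = refl

countFin-≤ : ∀ {n} (p : Fin n → Bool) → countFin p ≤ n
countFin-≤ {zero}  p = z≤n
countFin-≤ {suc n} p = +-mono-≤ (⟦⟧≤1 (p zero)) (countFin-≤ (p ∘ suc))
  where
  ⟦⟧≤1 : ∀ a → ⟦ a ⟧ ≤ 1
  ⟦⟧≤1 true  = ≤-refl
  ⟦⟧≤1 false = z≤n

countFin-≟ : ∀ {n} (x : Fin n) → countFin (λ v → ⌊ v ≟ x ⌋) ≡ 1
countFin-≟ {suc n} zero    = cong suc (sum-replicate-zero n)
countFin-≟ {suc n} (suc x) =
  trans (countFin-cong _ _ λ v → ⌊⌋-map′ (cong suc) suc-injective (v ≟ x)) (countFin-≟ x)

countFin-markov : ∀ {n} (g : Fin n → ℕ) D → countFin (λ v → D ≤ᵇ g v) * D ≤ sum g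
countFin-markov g D =
  ≤-trans (≤-reflexive (*-distribʳ-sum D (⟦_⟧ ∘ λ v → D ≤ᵇ g v))) (sum-mono-≤ λ v → weighted (g v))
  where
  weighted : ∀ x → ⟦ D ≤ᵇ x ⟧ * D ≤ x
  weighted x with D ≤ᵇ x in eq
  ... | false = z≤n
  ... | true  = ≤-trans (≤-reflexive (+-identityʳ D)) (≤ᵇ⇒≤ D x (subst T (sym eq) _))

least-witness : ∀ {n} (p : Fin n → Bool) → 0 < countFin p →
        ∃[ v ] T (p v) × (∀ w → toℕ w < toℕ v → ¬ T (p w))
least-witness {suc n} p pos with p zero in p0
... | true  = zero , subst T (sym p0) _ , λ _ ()
... | false with least-witness (p ∘ suc) pos
...   | v , pv , below = suc v , pv , earlier
  where
  earlier : ∀ w → toℕ w < toℕ (suc v) → ¬ T (p w)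
  earlier zero    _         pw = subst T p0 pw
  earlier (suc w) (s≤s w<v) pw = below w w<v pw

count-∷ : ∀ {A : Set} (p : A → Bool) x xs → count p (x ∷ xs) ≡ ⟦ p x ⟧ + count p xs
count-∷ p x xs with p x
... | true  = refl
... | false = refl

count-++ : ∀ {A : Set} (p : A → Bool) xs ys → count p (xs ++ ys) ≡ count p xs + count p ys
count-++ p []       ys = refl
count-++ p (x ∷ xs) ys = begin
  count p (x ∷ xs ++ ys)            ≡⟨ count-∷ p x (xs ++ ys) ⟩
  ⟦ p x ⟧ + count p (xs ++ ys)      ≡⟨ cong (⟦ p x ⟧ +_) (count-++ p xs ys) ⟩
  ⟦ p x ⟧ + (count p xs + count p ys) ≡⟨ +-assoc ⟦ p x ⟧ _ _ ⟨
  (⟦ p x ⟧ + count p xs) + count p ys ≡⟨ cong (_+ count p ys) (count-∷ p x xs) ⟨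
  count p (x ∷ xs) + count p ys     ∎
  where open ≡-Reasoning

count-map : ∀ {A B : Set} (p : B → Bool) (f : A → B) xs → count p (map f xs) ≡ count (p ∘ f) xs
count-map p f []       = refl
count-map p f (x ∷ xs) = trans (count-∷ p (f x) (map f xs))
  (trans (cong (⟦ p (f x) ⟧ +_) (count-map p f xs)) (sym (count-∷ (p ∘ f) x xs)))

count-tabulate : ∀ {A : Set} {n} (p : A → Bool) (f : Fin n → A) → count p (tabulate f) ≡ countFin (p ∘ f)
count-tabulate {n = zero}  p f = refl
count-tabulate {n = suc n} p f =
  trans (count-∷ p (f zero) (tabulate (f ∘ suc))) (cong (⟦ p (f zero) ⟧ +_) (count-tabulate p (f ∘ suc)))

count-allFin : ∀ {n} (p : Fin n → Bool) → count p (allFin n) ≡ countFin p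
count-allFin p = count-tabulate p id

count-cartesianProduct : ∀ {A B : Set} {n} (p : A × B → Bool) (f : Fin n → A) (ys : List B) →
  count p (cartesianProduct (tabulate f) ys) ≡ sum (λ u → count (λ y → p (f u , y)) ys)
count-cartesianProduct {n = zero}  p f ys = refl
count-cartesianProduct {n = suc n} p f ys =
  trans (count-++ p (map (f zero ,_) ys) _)
        (cong₂ _+_ (count-map p (f zero ,_) ys) (count-cartesianProduct p (f ∘ suc) ys))

forwardDegree : ∀ {n} → (Fin n → Fin n → Bool) → Fin n → ℕ
forwardDegree E v = countFin (λ w → (toℕ v <ᵇ toℕ w) ∧ E v w)

greenEdges-sum : ∀ {n} (c : Colouring n) →
                 greenEdges c ≡ sum (forwardDegree (λ u v → isGreen (c u v)))
greenEdges-sum {n} c = trans (count-cartesianProduct forwardGreen id (allFin n))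
                             (sum-cong-≗ λ u → count-allFin (λ v → forwardGreen (u , v)))
  where
  forwardGreen : Fin n × Fin n → Bool
  forwardGreen (u , v) = (toℕ u <ᵇ toℕ v) ∧ isGreen (c u v)

-- Ramsey's theorem for two-coloured lists

AllPairs-resp-⊆ : ∀ {A : Set} {R : A → A → Set} {xs ys : List A} → xs ⊆ ys → AllPairs R ys → AllPairs R xs
AllPairs-resp-⊆ []           []       = []
AllPairs-resp-⊆ (_ ∷ʳ xs⊆ys) (_ ∷ ps) = AllPairs-resp-⊆ xs⊆ys ps
AllPairs-resp-⊆ (refl ∷ xs⊆ys) (p ∷ ps) = All-resp-⊆ xs⊆ys p ∷ AllPairs-resp-⊆ xs⊆ys ps

record Bipartition {A : Set} (P Q : A → Set) (xs : List A) : Set where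
  field
    left right   : List A
    left⊆        : left ⊆ xs
    right⊆       : right ⊆ xs
    all-left     : All P left
    all-right    : All Q right
    length-split : length left + length right ≡ length xs

bipartition : ∀ {A : Set} {P Q : A → Set} {xs : List A} → All (λ x → P x ⊎ Q x) xs → Bipartition P Q xs
bipartition [] = record
  { left = [] ; right = [] ; left⊆ = [] ; right⊆ = [] ; all-left = [] ; all-right = [] ; length-split = refl }
bipartition {xs = x ∷ _} (inj₁ px ∷ rest) = record
  { left = x ∷ left ; right = right ; left⊆ = refl ∷ left⊆ ; right⊆ = x ∷ʳ right⊆
  ; all-left = px ∷ all-left ; all-right = all-right ; length-split = cong suc length-split }
  where open Bipartition (bipartition rest)
bipartition {xs = x ∷ _} (inj₂ qx ∷ rest) = record
  { left = left ; right = x ∷ right ; left⊆ = x ∷ʳ left⊆ ; right⊆ = refl ∷ right⊆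
  ; all-left = all-left ; all-right = qx ∷ all-right
  ; length-split = trans (+-suc (length left) (length right)) (cong suc length-split) }
  where open Bipartition (bipartition rest)

Clique : ∀ {A : Set} → (A → A → Set) → ℕ → List A → Set
Clique R m K = length K ≡ m × AllPairs R K

pigeonhole-+ : ∀ m a b → 2 * m ≤ suc (a + b) → m ≤ a ⊎ m ≤ b
pigeonhole-+ m a b 2m≤ with m ≤? a | m ≤? b
... | yes m≤a | _       = inj₁ m≤a
... | no  _   | yes m≤b = inj₂ m≤b
... | no  m≰a | no  m≰b = ⊥-elim (<⇒≱ (≤-trans lower (≤-reflexive 2*m≡m+m)) 2m≤)
  where
  lower : suc (suc (a + b)) ≤ m + m
  lower = subst (_≤ m + m) (cong suc (+-suc a b)) (+-mono-≤ (≰⇒> m≰a) (≰⇒> m≰b))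
  2*m≡m+m : m + m ≡ 2 * m
  2*m≡m+m = cong (m +_) (sym (+-identityʳ m))

module _ {A : Set} {R B : A → A → Set} where

  ramsey : ∀ s t (L : List A) → AllPairs (λ x y → R x y ⊎ B x y) L → 2 ^ (s + t) ≤ length L →
           ∃[ K ] K ⊆ L × (Clique R s K ⊎ Clique B t K)
  ramsey zero    t       L _ _ = [] , minimum L , inj₁ (refl , [])
  ramsey (suc s) zero    L _ _ = [] , minimum L , inj₂ (refl , [])
  ramsey (suc s) (suc t) [] _ 2^≤0 = ⊥-elim (<⇒≱ (m^n>0 2 (suc s + suc t)) 2^≤0)
  ramsey (suc s) (suc t) (x ∷ xs) (x-edges ∷ edges) 2^≤
    with split ← bipartition x-edges
       | pigeonhole-+ (2 ^ (s + suc t)) _ _ (subst (2 ^ (suc s + suc t) ≤_) (cong suc (sym (Bipartition.length-split split))) 2^≤)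
  ... | inj₁ enough-red  = extendRed (ramsey s (suc t) left (AllPairs-resp-⊆ left⊆ edges) enough-red)
    where
    open Bipartition split
    extendRed : ∃[ K ] K ⊆ left × (Clique R s K ⊎ Clique B (suc t) K) →
                ∃[ K ] K ⊆ x ∷ xs × (Clique R (suc s) K ⊎ Clique B (suc t) K)
    extendRed (K , K⊆ , inj₁ (len , reds)) =
      x ∷ K , refl ∷ ⊆-trans K⊆ left⊆ , inj₁ (cong suc len , All-resp-⊆ K⊆ all-left ∷ reds)
    extendRed (K , K⊆ , inj₂ blues) = K , x ∷ʳ ⊆-trans K⊆ left⊆ , inj₂ blues
  ... | inj₂ enough-blue = extendBlue (ramsey (suc s) t right (AllPairs-resp-⊆ right⊆ edges)
                                        (subst (λ e → 2 ^ e ≤ length right) (+-suc s t) enough-blue))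
    where
    open Bipartition split
    extendBlue : ∃[ K ] K ⊆ right × (Clique R (suc s) K ⊎ Clique B t K) →
                 ∃[ K ] K ⊆ x ∷ xs × (Clique R (suc s) K ⊎ Clique B (suc t) K)
    extendBlue (K , K⊆ , inj₁ reds) = K , x ∷ʳ ⊆-trans K⊆ right⊆ , inj₁ reds
    extendBlue (K , K⊆ , inj₂ (len , blues)) =
      x ∷ K , refl ∷ ⊆-trans K⊆ right⊆ , inj₂ (cong suc len , All-resp-⊆ K⊆ all-right ∷ blues)

-- Greedy independent sets

greedy-budget-step : ∀ n A j s d s′ → (n + A) + j * (n + A) ≤ A * s → s ≤ 1 + (d + s′) → d * A < n →
                     j * (n + A) ≤ A * s′
greedy-budget-step n A j s d s′ budget s≤ dA<n = +-cancelˡ-≤ (n + A) _ _ (begin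
  (n + A) + j * (n + A)  ≤⟨ budget ⟩
  A * s                  ≤⟨ *-monoʳ-≤ A s≤ ⟩
  A * (1 + (d + s′))     ≡⟨ expand A d s′ ⟩
  (A + d * A) + A * s′   ≤⟨ +-monoˡ-≤ (A * s′) (+-monoʳ-≤ A (<⇒≤ dA<n)) ⟩
  (A + n) + A * s′       ≡⟨ cong (_+ A * s′) (+-comm A n) ⟩
  (n + A) + A * s′       ∎)
  where
  open ≤-Reasoning
  expand : ∀ A d s′ → A * (1 + (d + s′)) ≡ (A + d * A) + A * s′
  expand = solve-∀

greedy-budget-pos : ∀ n A j s → 0 < A → (n + A) + j * (n + A) ≤ A * s → 0 < s
greedy-budget-pos n A j s A>0 budget = *-cancelˡ-< A 0 s (begin-strict
  A * 0                  ≡⟨ *-zeroʳ A ⟩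
  0                      <⟨ ≤-trans A>0 (m≤n+m A n) ⟩
  n + A                  ≤⟨ m≤m+n (n + A) (j * (n + A)) ⟩
  (n + A) + j * (n + A)  ≤⟨ budget ⟩
  A * s                  ∎)
  where open ≤-Reasoning

module _ {n : ℕ} (E : Fin n → Fin n → Bool) where

  Independent : List (Fin n) → Set
  Independent = AllPairs (λ v w → toℕ v < toℕ w × ¬ T (E v w))

  laterNonNeighbours : (Fin n → Bool) → Fin n → Fin n → Bool
  laterNonNeighbours S v w = S w ∧ ((toℕ v <ᵇ toℕ w) ∧ not (E v w))

  laterNonNeighbours⇒S : ∀ S v w → T (laterNonNeighbours S v w) → T (S w)
  laterNonNeighbours⇒S S v w = proj₁ ∘ T-∧⁻ (S w)

  laterNonNeighbours⇒independent : ∀ S v w → T (laterNonNeighbours S v w) → toℕ v < toℕ w × ¬ T (E v w)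
  laterNonNeighbours⇒independent S v w later with T-∧⁻ (toℕ v <ᵇ toℕ w) (proj₂ (T-∧⁻ (S w) later))
  ... | v<w , notE = <ᵇ⇒< (toℕ v) (toℕ w) v<w , T-not⇒¬T (E v w) notE

  countFin-laterNonNeighbours : ∀ S v → (∀ w → toℕ w < toℕ v → ¬ T (S w)) →
    countFin S ≤ 1 + (forwardDegree E v + countFin (laterNonNeighbours S v))
  countFin-laterNonNeighbours S v v-least = begin
    countFin S                                          ≤⟨ countFin-mono S _ cover ⟩
    countFin (λ w → ⌊ w ≟ v ⌋ ∨ (forward w ∨ later w))  ≤⟨ countFin-∨ (λ w → ⌊ w ≟ v ⌋) _ ⟩
    countFin (λ w → ⌊ w ≟ v ⌋) + countFin (λ w → forward w ∨ later w)
                                          ≤⟨ +-mono-≤ (≤-reflexive (countFin-≟ v)) (countFin-∨ forward later) ⟩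
    1 + (forwardDegree E v + countFin later)            ∎
    where
    open ≤-Reasoning
    forward later : Fin n → Bool
    forward w = (toℕ v <ᵇ toℕ w) ∧ E v w
    later = laterNonNeighbours S v
    cover : ∀ w → T (S w) → T (⌊ w ≟ v ⌋ ∨ (forward w ∨ later w))
    cover w Sw with <-cmp (toℕ w) (toℕ v)
    ... | tri< w<v _ _ = ⊥-elim (v-least w w<v Sw)
    ... | tri≈ _ w≡v _ = T-∨⁺ ⌊ w ≟ v ⌋ (inj₁ (fromWitness {a? = w ≟ v} (toℕ-injective w≡v)))
    ... | tri> _ _ v<w with T? (E v w)
    ...   | yes edge  = T-∨⁺ ⌊ w ≟ v ⌋ (inj₂ (T-∨⁺ (forward w) (inj₁ (T-∧⁺ (<⇒<ᵇ v<w , edge)))))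
    ...   | no  ¬edge = T-∨⁺ ⌊ w ≟ v ⌋ (inj₂ (T-∨⁺ (forward w) (inj₂
                          (T-∧⁺ (Sw , T-∧⁺ (<⇒<ᵇ v<w , ¬T⇒T-not (E v w) ¬edge))))))

  -- The hypotheses say that every vertex of S has fewer than n/A forward neighbours and that
  -- |S| ≥ j (n/A + 1), multiplied out by A.
  greedy-independent : ∀ A → 0 < A → ∀ j (S : Fin n → Bool) →
    (∀ v → T (S v) → forwardDegree E v * A < n) → j * (n + A) ≤ A * countFin S →
    ∃[ L ] length L ≡ j × All (T ∘ S) L × Independent L
  greedy-independent A A>0 zero    S sparse budget = [] , refl , [] , []
  greedy-independent A A>0 (suc j) S sparse budget
    with v , Sv , v-least ← least-witness S (greedy-budget-pos n A j (countFin S) A>0 budget)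
    with L , L-size , L-later , L-independent ←
         greedy-independent A A>0 j (laterNonNeighbours S v)
           (λ w → sparse w ∘ laterNonNeighbours⇒S S v w)
           (greedy-budget-step n A j (countFin S) (forwardDegree E v) _ budget
              (countFin-laterNonNeighbours S v v-least) (sparse v Sv))
    = v ∷ L , cong suc L-size ,
      Sv ∷ All.map (laterNonNeighbours⇒S S v _) L-later ,
      All.map (laterNonNeighbours⇒independent S v _) L-later ∷ L-independent

AllPairs-∈ : ∀ {A : Set} {R : A → A → Set} {xs : List A} {x y : A} → (∀ {u v} → R u v → R v u) →
             AllPairs R xs → x ∈ xs → y ∈ xs → x ≢ y → R x y
AllPairs-∈ R-sym (_ ∷ _)   (here refl) (here refl) x≢y = ⊥-elim (x≢y refl)
AllPairs-∈ R-sym (rx ∷ _)  (here refl) (there y∈)  _   = All.lookup rx y∈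
AllPairs-∈ R-sym (ry ∷ _)  (there x∈)  (here refl) _   = R-sym (All.lookup ry x∈)
AllPairs-∈ R-sym (_ ∷ rs)  (there x∈)  (there y∈)  x≢y = AllPairs-∈ R-sym rs x∈ y∈ x≢y

∈?-∷ : ∀ {n} (v x : Fin n) K → ⌊ v ∈? x ∷ K ⌋ ≡ ⌊ v ≟ x ⌋ ∨ ⌊ v ∈? K ⌋
∈?-∷ v x K = trans (isYes≗does (v ∈? x ∷ K))
                   (sym (cong₂ _∨_ (isYes≗does (v ≟ x)) (isYes≗does (v ∈? K))))

countFin-∈ : ∀ {n} (K : List (Fin n)) → Unique K → countFin (λ v → ⌊ v ∈? K ⌋) ≡ length K
countFin-∈ {n} []      []            = sum-replicate-zero n
countFin-∈     (x ∷ K) (x∉K ∷ uniq) = begin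
  countFin (λ v → ⌊ v ∈? x ∷ K ⌋)                ≡⟨ countFin-cong _ (λ v → ⌊ v ≟ x ⌋ ∨ ⌊ v ∈? K ⌋) (λ v → ∈?-∷ v x K) ⟩
  countFin (λ v → ⌊ v ≟ x ⌋ ∨ ⌊ v ∈? K ⌋)          ≡⟨ countFin-∨-disjoint (λ v → ⌊ v ≟ x ⌋) (λ v → ⌊ v ∈? K ⌋) disjoint ⟩
  countFin (λ v → ⌊ v ≟ x ⌋) + countFin (λ v → ⌊ v ∈? K ⌋) ≡⟨ cong₂ _+_ (countFin-≟ x) (countFin-∈ K uniq) ⟩
  suc (length K)                                 ∎
  where
  open ≡-Reasoning
  disjoint : ∀ v → T ⌊ v ≟ x ⌋ → T ⌊ v ∈? K ⌋ → ⊥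
  disjoint v v≡x v∈K with toWitness v≡x
  ... | refl = All.lookup x∉K (toWitness v∈K) refl

≟-injective : ∀ {m n} (f : Fin m → Fin n) → (∀ {x y} → f x ≡ f y → x ≡ y) →
              ∀ x y → ⌊ f x ≟ f y ⌋ ≡ ⌊ x ≟ y ⌋
≟-injective f f-inj x y with x ≟ y
... | yes refl = trans (isYes≗does (f x ≟ f x)) (dec-true (f x ≟ f x) refl)
... | no  x≢y  = trans (isYes≗does (f x ≟ f y)) (dec-false (f x ≟ f y) (x≢y ∘ f-inj))

module _ {n : ℕ} where

  inBlock : ∀ {q} → (Fin n → Fin (suc q)) → Fin (suc q) → Fin n → Bool
  inBlock part i v = ⌊ part v ≟ i ⌋

  blockSize-countFin : ∀ {q} (part : Fin n → Fin (suc q)) i → blockSize part i ≡ countFin (inBlock part i)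
  blockSize-countFin part i = count-allFin (inBlock part i)

  insertBlock : ∀ {q} → (Fin n → Fin (suc q)) → List (Fin n) → Fin n → Fin (suc (suc q))
  insertBlock part K v with v ∈? K
  ... | yes _ = suc zero
  ... | no  _ = punchIn (suc zero) (part v)

  ≟-punchIn₁ : ∀ {q} (i j : Fin (suc q)) → ⌊ punchIn (suc zero) i ≟ punchIn (suc zero) j ⌋ ≡ ⌊ i ≟ j ⌋
  ≟-punchIn₁ = ≟-injective (punchIn (suc zero)) (punchIn-injective (suc zero) _ _)

  module _ {q : ℕ} (part : Fin n → Fin (suc q)) (K : List (Fin n)) where

    inBlock-insertBlock-new : ∀ v → inBlock (insertBlock part K) (suc zero) v ≡ ⌊ v ∈? K ⌋
    inBlock-insertBlock-new v with v ∈? K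
    ... | yes _ = refl
    ... | no  _ = trans (isYes≗does (punchIn (suc zero) (part v) ≟ suc zero))
                        (dec-false (punchIn (suc zero) (part v) ≟ suc zero) (punchInᵢ≢i (suc zero) (part v)))

    insertBlock-new⁻ : ∀ v → insertBlock part K v ≡ suc zero → v ∈ K
    insertBlock-new⁻ v with v ∈? K
    ... | yes v∈K = λ _ → v∈K
    ... | no  _   = ⊥-elim ∘ punchInᵢ≢i (suc zero) (part v)

    inBlock-insertBlock-V₀ : ∀ v → v ∈ K → inBlock (insertBlock part K) zero v ≡ false
    inBlock-insertBlock-V₀ v v∈K with v ∈? K
    ... | yes _   = refl
    ... | no  v∉K = ⊥-elim (v∉K v∈K)

    module _ (K⊆V₀ : All (λ v → part v ≡ zero) K) where

      inBlock-insertBlock-old : ∀ i v → inBlock (insertBlock part K) (suc (suc i)) v ≡ inBlock part (suc i) v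
      inBlock-insertBlock-old i v with v ∈? K
      ... | yes v∈K rewrite All.lookup K⊆V₀ v∈K = refl
      ... | no  _   = ≟-punchIn₁ (part v) (suc i)

      insertBlock-old⁻ : ∀ i v → insertBlock part K v ≡ suc (suc i) → part v ≡ suc i
      insertBlock-old⁻ i v with v ∈? K
      ... | yes _ = λ ()
      ... | no  _ = punchIn-injective (suc zero) (part v) (suc i)

    countFin-insertBlock-V₀ : (p : Fin n → Bool) → Unique K → All (λ v → T (inBlock part zero v ∧ p v)) K →
      countFin (λ v → inBlock part zero v ∧ p v) ≡ countFin (λ v → inBlock (insertBlock part K) zero v ∧ p v) + length K
    countFin-insertBlock-V₀ p K-unique K⊆ = begin
      countFin (λ v → inBlock part zero v ∧ p v)                  ≡⟨ countFin-cong _ (λ v → p′ v ∨ ⌊ v ∈? K ⌋) split ⟩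
      countFin (λ v → p′ v ∨ ⌊ v ∈? K ⌋)                          ≡⟨ countFin-∨-disjoint p′ (λ v → ⌊ v ∈? K ⌋) disjoint ⟩
      countFin p′ + countFin (λ v → ⌊ v ∈? K ⌋)                  ≡⟨ cong (countFin p′ +_) (countFin-∈ K K-unique) ⟩
      countFin p′ + length K                                     ∎
      where
      open ≡-Reasoning
      p′ : Fin n → Bool
      p′ v = inBlock (insertBlock part K) zero v ∧ p v
      split : ∀ v → inBlock part zero v ∧ p v ≡ p′ v ∨ ⌊ v ∈? K ⌋
      split v with v ∈? K
      ... | yes v∈K = trans (Equivalence.to T-≡ (All.lookup K⊆ v∈K)) (sym (∨-zeroʳ false))
      ... | no  _   = sym (trans (∨-identityʳ _) (cong (_∧ p v) (≟-punchIn₁ (part v) zero)))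
      disjoint : ∀ v → T (p′ v) → T ⌊ v ∈? K ⌋ → ⊥
      disjoint v p′v v∈K =
        subst T (inBlock-insertBlock-V₀ v (toWitness v∈K)) (proj₁ (T-∧⁻ (inBlock (insertBlock part K) zero v) p′v))

module _ {n : ℕ} (c : Colouring n) (b : ℕ) where

  record GoodPartition : Set where
    field
      q    : ℕ
      part : Fin n → Fin (suc q)
      good : (i : Fin q) → blockSize part (suc i) ≡ b × MonoRedOrBlue c part (suc i)

  open GoodPartition

  unpartitioned : GoodPartition
  unpartitioned = record { q = 0 ; part = λ _ → zero ; good = λ () }

  addBlock : SymmetricColouring c → (P : GoodPartition) (K : List (Fin n)) (col : Colour) →
             col ≡ red ⊎ col ≡ blue → Unique K → length K ≡ b → All (λ v → part P v ≡ zero) K →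
             AllPairs (λ u v → c u v ≡ col) K → GoodPartition
  addBlock c-sym P K col col-rb K-unique K-size K⊆V₀ K-mono =
    record { q = suc (q P) ; part = part′ ; good = good′ }
    where
    part′ : Fin n → Fin (suc (suc (q P)))
    part′ = insertBlock (part P) K
    good′ : (i : Fin (suc (q P))) → blockSize part′ (suc i) ≡ b × MonoRedOrBlue c part′ (suc i)
    good′ zero = size , col , col-rb , mono
      where
      size : blockSize part′ (suc zero) ≡ b
      size = begin
        blockSize part′ (suc zero)            ≡⟨ blockSize-countFin part′ (suc zero) ⟩
        countFin (inBlock part′ (suc zero))   ≡⟨ countFin-cong _ _ (inBlock-insertBlock-new (part P) K) ⟩
        countFin (λ v → ⌊ v ∈? K ⌋)           ≡⟨ countFin-∈ K K-unique ⟩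
        length K                              ≡⟨ K-size ⟩
        b                                     ∎
        where open ≡-Reasoning
      mono : ∀ u v → part′ u ≡ suc zero → part′ v ≡ suc zero → u ≢ v → c u v ≡ col
      mono u v u∈ v∈ = AllPairs-∈ (λ {x} {y} cxy≡col → trans (c-sym y x) cxy≡col) K-mono
                         (insertBlock-new⁻ (part P) K u u∈) (insertBlock-new⁻ (part P) K v v∈)
    good′ (suc i) with size , col₀ , col₀-rb , mono ← good P i = size′ , col₀ , col₀-rb , mono′
      where
      size′ : blockSize part′ (suc (suc i)) ≡ b
      size′ = begin
        blockSize part′ (suc (suc i))          ≡⟨ blockSize-countFin part′ (suc (suc i)) ⟩
        countFin (inBlock part′ (suc (suc i))) ≡⟨ countFin-cong _ _ (inBlock-insertBlock-old (part P) K K⊆V₀ i) ⟩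
        countFin (inBlock (part P) (suc i))    ≡⟨ blockSize-countFin (part P) (suc i) ⟨
        blockSize (part P) (suc i)             ≡⟨ size ⟩
        b                                      ∎
        where open ≡-Reasoning
      mono′ : ∀ u v → part′ u ≡ suc (suc i) → part′ v ≡ suc (suc i) → u ≢ v → c u v ≡ col₀
      mono′ u v u∈ v∈ = mono u v (insertBlock-old⁻ (part P) K K⊆V₀ i u u∈) (insertBlock-old⁻ (part P) K K⊆V₀ i v v∈)

-- Exhausting the low vertices

nonGreen : ∀ col → ¬ T (isGreen col) → col ≡ red ⊎ col ≡ blue
nonGreen red   _  = inj₁ refl
nonGreen blue  _  = inj₂ refl
nonGreen green ¬g = ⊥-elim (¬g _)

module _ {n : ℕ} (c : Colouring n) (A : ℕ) where

  greenGraph : Fin n → Fin n → Bool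
  greenGraph u v = isGreen (c u v)

  high : Fin n → Bool
  high v = n ≤ᵇ forwardDegree greenGraph v * A

  countFin-high : countFin high * n ≤ greenEdges c * A
  countFin-high = begin
    countFin high * n                          ≤⟨ countFin-markov (λ v → forwardDegree greenGraph v * A) n ⟩
    sum (λ v → forwardDegree greenGraph v * A) ≡⟨ *-distribʳ-sum A (forwardDegree greenGraph) ⟨
    sum (forwardDegree greenGraph) * A         ≡⟨ cong (_* A) (greenEdges-sum c) ⟨
    greenEdges c * A                           ∎
    where open ≤-Reasoning

  module _ (b : ℕ) where

    open GoodPartition

    remaining : GoodPartition c b → Fin n → Bool
    remaining P v = inBlock (part P) zero v ∧ not (high v)

    V₀-bound : ∀ P → blockSize (part P) zero ≤ countFin high + countFin (remaining P)
    V₀-bound P = begin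
      blockSize (part P) zero                  ≡⟨ blockSize-countFin (part P) zero ⟩
      countFin (inBlock (part P) zero)         ≤⟨ countFin-mono _ (λ v → high v ∨ remaining P v) covered ⟩
      countFin (λ v → high v ∨ remaining P v)  ≤⟨ countFin-∨ high (remaining P) ⟩
      countFin high + countFin (remaining P)   ∎
      where
      open ≤-Reasoning
      covered : ∀ v → T (inBlock (part P) zero v) → T (high v ∨ remaining P v)
      covered v inV₀ with high v
      ... | true  = _
      ... | false = T-∧⁺ (inV₀ , _)

    remaining-sparse : ∀ P v → T (remaining P v) → forwardDegree greenGraph v * A < n
    remaining-sparse P v rem = ≰⇒> (T-not⇒¬T (high v) (proj₂ (T-∧⁻ (inBlock (part P) zero v) rem)) ∘ ≤⇒≤ᵇ)

    module _ (c-sym : SymmetricColouring c) (A>0 : 0 < A) where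

      extractBlock : (P : GoodPartition c b) → 2 ^ (b + b) * (n + A) ≤ A * countFin (remaining P) →
                     ∃[ P′ ] countFin (remaining P) ≡ countFin (remaining P′) + b
      extractBlock P many
        with L , L-size , L-remaining , L-independent ←
             greedy-independent greenGraph A A>0 (2 ^ (b + b)) (remaining P) (remaining-sparse P) many
        with K , K⊆L , clique ←
             ramsey b b L (AllPairs.map (λ {u} {v} → nonGreen (c u v) ∘ proj₂) L-independent) (≤-reflexive (sym L-size))
        = [ add red (inj₁ refl) , add blue (inj₂ refl) ]′ clique
        where
        K-remaining : All (T ∘ remaining P) K
        K-remaining = All-resp-⊆ K⊆L L-remaining
        K-unique : Unique K
        K-unique = AllPairs-resp-⊆ K⊆L (AllPairs.map (λ (v<w , _) v≡w → <-irrefl (cong toℕ v≡w) v<w) L-independent)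
        K⊆V₀ : All (λ v → part P v ≡ zero) K
        K⊆V₀ = All.map (λ {v} rem → toWitness (proj₁ (T-∧⁻ (inBlock (part P) zero v) rem))) K-remaining
        add : ∀ col → col ≡ red ⊎ col ≡ blue → Clique (λ u v → c u v ≡ col) b K →
              ∃[ P′ ] countFin (remaining P) ≡ countFin (remaining P′) + b
        add col col-rb (K-size , K-mono) =
          addBlock c b c-sym P K col col-rb K-unique K-size K⊆V₀ K-mono ,
          trans (countFin-insertBlock-V₀ (part P) K (not ∘ high) K-unique K-remaining)
                (cong (countFin (λ v → inBlock (insertBlock (part P) K) zero v ∧ not (high v)) +_) K-size)

      exhaust : 0 < b → ∀ fuel (P : GoodPartition c b) → countFin (remaining P) ≤ fuel →
                ∃[ P′ ] A * countFin (remaining P′) < 2 ^ (b + b) * (n + A)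
      exhaust b>0 fuel P bound with A * countFin (remaining P) <? 2 ^ (b + b) * (n + A)
      ... | yes few  = P , few
      ... | no  many with P′ , shrink ← extractBlock P (≮⇒≥ many) = continue fuel bound
        where
        fewer : countFin (remaining P′) < countFin (remaining P)
        fewer = ≤-trans (m<m+n (countFin (remaining P′)) b>0) (≤-reflexive (sym shrink))
        continue : ∀ fuel → countFin (remaining P) ≤ fuel →
                   ∃[ P″ ] A * countFin (remaining P″) < 2 ^ (b + b) * (n + A)
        continue zero       bound = ⊥-elim (<⇒≱ (≤-trans fewer bound) z≤n)
        continue (suc fuel) bound = exhaust b>0 fuel P′ (≤-pred (≤-trans fewer bound))

*-positive : ∀ m n → 0 < m → 0 < n → 0 < m * n
*-positive (suc m) (suc n) _ _ = s≤s z≤n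

few-high-vertices : ∀ H n e A M → 0 < A → H * n ≤ e * A → e * suc (M * A) < n * n → H * M < n
few-high-vertices H n e A M A>0 markov few-green = *-cancelʳ-< (A * n) (H * M) n (begin-strict
  H * M * (A * n)         ≡⟨ reorder₁ H M A n ⟩
  A * (H * n * M)         ≤⟨ *-monoʳ-≤ A (*-monoˡ-≤ M markov) ⟩
  A * (e * A * M)         ≡⟨ cong (A *_) (reorder₂ e A M) ⟩
  A * (e * (M * A))       ≤⟨ *-monoʳ-≤ A (*-monoʳ-≤ e (n≤1+n (M * A))) ⟩
  A * (e * suc (M * A))   <⟨ *-monoʳ-< A {{>-nonZero A>0}} few-green ⟩
  A * (n * n)             ≡⟨ reorder₃ A n ⟩
  n * (A * n)             ∎)
  where
  open ≤-Reasoning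
  reorder₁ : ∀ H M A n → H * M * (A * n) ≡ A * (H * n * M)
  reorder₁ = solve-∀
  reorder₂ : ∀ e A M → e * A * M ≡ e * (M * A)
  reorder₂ = solve-∀
  reorder₃ : ∀ A n → A * (n * n) ≡ n * (A * n)
  reorder₃ = solve-∀

few-remaining-vertices : ∀ R n M N → 2 * M * N * R < N * (n + 2 * M * N) → 2 * M * N ≤ n → R * M < n
few-remaining-vertices R n M N exhausted A≤n = *-cancelʳ-< (2 * N) (R * M) n (begin-strict
  R * M * (2 * N)       ≡⟨ reorder₁ R M N ⟩
  2 * M * N * R         <⟨ exhausted ⟩
  N * (n + 2 * M * N)   ≤⟨ *-monoʳ-≤ N (+-monoʳ-≤ n A≤n) ⟩
  N * (n + n)           ≡⟨ reorder₂ N n ⟩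
  n * (2 * N)           ∎)
  where
  open ≤-Reasoning
  reorder₁ : ∀ R M N → R * M * (2 * N) ≡ 2 * M * N * R
  reorder₁ = solve-∀
  reorder₂ : ∀ N n → N * (n + n) ≡ n * (2 * N)
  reorder₂ = solve-∀

sum-of-halves-< : ∀ V H R n k → V ≤ H + R → H * (2 * k) < n → R * (2 * k) < n → V * k < n
sum-of-halves-< V H R n k V≤ H<n R<n = *-cancelʳ-< 2 (V * k) n (begin-strict
  V * k * 2                   ≡⟨ reorder V k ⟩
  V * (2 * k)                 ≤⟨ *-monoˡ-≤ (2 * k) V≤ ⟩
  (H + R) * (2 * k)           ≡⟨ *-distribʳ-+ (2 * k) H R ⟩
  H * (2 * k) + R * (2 * k)   <⟨ +-mono-< H<n R<n ⟩
  n + n                       ≡⟨ double n ⟩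
  n * 2                       ∎)
  where
  open ≤-Reasoning
  reorder : ∀ V k → V * k * 2 ≡ V * (2 * k)
  reorder = solve-∀
  double : ∀ n → n + n ≡ n * 2
  double = solve-∀

module _ (b k : ℕ) where

  degreeScale : ℕ
  degreeScale = 2 * (2 * k) * 2 ^ (b + b)

  greenScale : ℕ
  greenScale = 2 * k * degreeScale

  degreeScale-pos : 0 < k → 0 < degreeScale
  degreeScale-pos k>0 = *-positive (2 * (2 * k)) (2 ^ (b + b)) (*-positive 2 (2 * k) z<s (*-positive 2 k z<s k>0))
                                   (m^n>0 2 (b + b))

  partition-small-V₀ : 0 < b → 0 < k → ∀ n → degreeScale < n →
    (c : Colouring n) → SymmetricColouring c → greenEdges c * suc greenScale < n * n →
    Σ (GoodPartition c b) λ P → blockSize (GoodPartition.part P) zero * k < n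
  partition-small-V₀ b>0 k>0 n scale<n c c-sym few-green
    with P , exhausted ← exhaust c degreeScale b c-sym (degreeScale-pos k>0) b>0 n (unpartitioned c b) (countFin-≤ _)
    = P , sum-of-halves-< (blockSize (GoodPartition.part P) zero) H R n k (V₀-bound c degreeScale b P)
            (few-high-vertices H n (greenEdges c) degreeScale (2 * k) (degreeScale-pos k>0)
               (countFin-high c degreeScale) few-green)
            (few-remaining-vertices R n (2 * k) (2 ^ (b + b)) exhausted (<⇒≤ scale<n))
    where
    H R : ℕ
    H = countFin (high c degreeScale)
    R = countFin (remaining c degreeScale b P)

-- Comparisons with rationals

module _ where

  open import Data.Integer using (+_; -[1+_]; +[1+_]; +<+)

  module _ (a x d b : ℕ) where

    private
      numerator-eq : + (a * suc (d * 1)) ≡ + a ℤ.* + suc (d * 1)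
      numerator-eq = ℤP.pos-* a (suc (d * 1))
      denominator-eq : + (x * b) ≡ (+ x ℤ.* + b) ℤ.* + 1
      denominator-eq = trans (ℤP.pos-* x b) (sym (ℤP.*-identityʳ (+ x ℤ.* + b)))
      d*1 : a * suc (d * 1) ≡ a * suc d
      d*1 = cong (λ m → a * suc m) (*-identityʳ d)

    ℕ<ᵘ*ℕ : a * suc d < x * b → mkℚᵘ (+ a) 0 <ᵘ mkℚᵘ (+ x) d *ᵘ mkℚᵘ (+ b) 0
    ℕ<ᵘ*ℕ lt = *<*ᵘ (subst₂ ℤ._<_ numerator-eq denominator-eq (+<+ (subst (_< x * b) (sym d*1) lt)))

    ℕ<ᵘ*ℕ⁻¹ : mkℚᵘ (+ a) 0 <ᵘ mkℚᵘ (+ x) d *ᵘ mkℚᵘ (+ b) 0 → a * suc d < x * b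
    ℕ<ᵘ*ℕ⁻¹ (*<*ᵘ lt) = subst (_< x * b) d*1 (ℤP.drop‿+<+ (subst₂ ℤ._<_ (sym numerator-eq) (sym denominator-eq) lt))

    module _ .(cop : Coprime x (suc d)) where

      private
        toℚᵘ-ℕ : ∀ m → toℚᵘ (ℕtoℚ m) ≃ᵘ mkℚᵘ (+ m) 0
        toℚᵘ-ℕ m = ℚP.toℚᵘ-fromℚᵘ (mkℚᵘ (+ m) 0)
        toℚᵘ-rhs : toℚᵘ (mkℚ (+ x) d cop *ℚ ℕtoℚ b) ≃ᵘ mkℚᵘ (+ x) d *ᵘ mkℚᵘ (+ b) 0
        toℚᵘ-rhs = ℚᵘP.≃-trans (ℚP.toℚᵘ-homo-* (mkℚ (+ x) d cop) (ℕtoℚ b)) (ℚᵘP.*-congˡ {mkℚᵘ (+ x) d} (toℚᵘ-ℕ b))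

      ℕ<*ℕ : a * suc d < x * b → ℕtoℚ a <ℚ mkℚ (+ x) d cop *ℚ ℕtoℚ b
      ℕ<*ℕ lt = ℚP.toℚᵘ-cancel-<
        (ℚᵘP.<-respˡ-≃ (ℚᵘP.≃-sym (toℚᵘ-ℕ a)) (ℚᵘP.<-respʳ-≃ (ℚᵘP.≃-sym toℚᵘ-rhs) (ℕ<ᵘ*ℕ lt)))

      ℕ<*ℕ⁻¹ : ℕtoℚ a <ℚ mkℚ (+ x) d cop *ℚ ℕtoℚ b → a * suc d < x * b
      ℕ<*ℕ⁻¹ lt = ℕ<ᵘ*ℕ⁻¹ (ℚᵘP.<-respˡ-≃ (toℚᵘ-ℕ a) (ℚᵘP.<-respʳ-≃ toℚᵘ-rhs (ℚP.toℚᵘ-mono-< lt)))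

  unitFraction : ℕ → ℚ
  unitFraction m = mkℚ (+ 1) m (1-coprimeTo (suc m))

  unitFraction-pos : ∀ m → 0ℚ <ℚ unitFraction m
  unitFraction-pos m = ℚP.positive⁻¹ (unitFraction m)

  ℕ<unitFraction*ℕ⁻¹ : ∀ a m b → ℕtoℚ a <ℚ unitFraction m *ℚ ℕtoℚ b → a * suc m < b
  ℕ<unitFraction*ℕ⁻¹ a m b lt = subst (a * suc m <_) (*-identityˡ b) (ℕ<*ℕ⁻¹ a 1 m b (1-coprimeTo (suc m)) lt)

  positive⇒scale : ∀ ε → 0ℚ <ℚ ε → ∃[ d ] (∀ a m → a * suc d < m → ℕtoℚ a <ℚ ε *ℚ ℕtoℚ m)
  positive⇒scale (mkℚ (+ zero)  _ _)   (*<* (+<+ ()))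
  positive⇒scale (mkℚ -[1+ _ ]  _ _)   (*<* ())
  positive⇒scale (mkℚ +[1+ p ]  d cop) _ =
    d , λ a m a*k<m → ℕ<*ℕ a (suc p) d m cop (≤-trans a*k<m (m≤m+n m (p * m)))

lemma16 : (ε : ℚ) → 0ℚ <ℚ ε → (b : ℕ) → 2 ≤ b →
    Σ ℚ λ γ → 0ℚ <ℚ γ × Σ ℕ λ n₀ → (n : ℕ) → suc n₀ ≤ n →
      (c : Colouring n) → SymmetricColouring c →
      ℕtoℚ (greenEdges c) <ℚ γ *ℚ ℕtoℚ (n * n) →
      Σ ℕ λ q → Σ (Fin n → Fin (suc q)) λ part →
        (ℕtoℚ (blockSize part zero) <ℚ ε *ℚ ℕtoℚ n) ×
        ((i : Fin q) → (blockSize part (suc i) ≡ b) × MonoRedOrBlue c part (suc i))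
lemma16 ε ε>0 b b≥2 with d , ε-scale ← positive⇒scale ε ε>0 =
  unitFraction (greenScale b (suc d)) , unitFraction-pos (greenScale b (suc d)) , degreeScale b (suc d) ,
  λ n scale<n c c-sym few-green →
    let P , V₀-small = partition-small-V₀ b (suc d) (≤-trans z<s b≥2) z<s n scale<n c c-sym
                         (ℕ<unitFraction*ℕ⁻¹ (greenEdges c) (greenScale b (suc d)) (n * n) few-green)
        open GoodPartition P
    in q , part , ε-scale (blockSize part zero) n V₀-small , good
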